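{- Let $G$ be a connected graph and $g\ge 0$ an integer such that $\kappa^g(G)$ exists. Then for every $g$-good-neighbor cut $X$ of $G$ with $|X|=\kappa^g(G)$, $c^g(G)\le \kappa^g(G)+\min\{c(X),a(X)\}$. Moreover, this bound is sharp.
   Context: For a graph $G=(V,E)$, a set $X\subseteq V$ is a $g$-good-neighbor cut if $G-X$ is disconnected and every vertex of $V\setminus X$ has at least $g$ neighbors in $V\setminus X$; $\kappa^g(G)$ is the minimum size of such a cut, and it exists if such a cut exists. For a $g$-good-neighbor cut $X$ and a component $C$ of $G-X$, call $C$ splittable if $V(C)$ can be partitioned into two nonempty sets $A,B$ with $\delta(G[A])\ge g$ and $\delta(G[B])\ge g$; among such partitions with $|A|\ge|B|$ take one minimizing $|A|-|B|$ and set $a(C)=|A|$. Let $a(X)$ be the minimum of $a(C)$ over splittable components of $G-X$ (the smallest such larger part), and $c(X)$ the minimum order of a non-splittable component of $G-X$ (minima over the empty set are $+\infty$). The gc number is $c^g(G)=\min_X\{|X|+\min\{a(X),c(X)\}\}$ over all $g$-good-neighbor cuts $X$. -}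

module Defs where

open import Data.Nat using (ℕ; _≤_; _+_; _∸_)
open import Data.Bool using (Bool; true; false)
open import Data.Fin using (Fin)
open import Data.Fin.Subset using (Subset; _∈_; _∉_; ∁; _∩_; _∪_; ⊤; ⊥; ∣_∣; Nonempty)
open import Data.Vec using (tabulate)
open import Data.Product using (Σ; ∃; _×_; _,_)
open import Data.Sum using (_⊎_)
open import Relation.Nullary using (¬_)
open import Relation.Binary.PropositionalEquality using (_≡_)

record Graph : Set where
  field
    n      : ℕ
    adj    : Fin n → Fin n → Bool
    sym    : ∀ u v → adj u v ≡ adj v u
    irrefl : ∀ v → adj v v ≡ false
open Graph public

module _ (G : Graph) where

  VSet : Set
  VSet = Subset (n G)

  N : Fin (n G) → VSet
  N v = tabulate (adj G v)

  degIn : VSet → Fin (n G) → ℕ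
  degIn S v = ∣ S ∩ N v ∣

  MinDeg≥ : ℕ → VSet → Set
  MinDeg≥ g S = ∀ v → v ∈ S → g ≤ degIn S v

  data Reach (S : VSet) (u : Fin (n G)) : Fin (n G) → Set where
    here : u ∈ S → Reach S u u
    step : ∀ {w v} → Reach S u w → adj G w v ≡ true → v ∈ S → Reach S u v

  ConnectedSet : VSet → Set
  ConnectedSet S = Nonempty S × (∀ u v → u ∈ S → v ∈ S → Reach S u v)

  DisconnectedSet : VSet → Set
  DisconnectedSet S = ∃ λ u → ∃ λ v → u ∈ S × v ∈ S × ¬ Reach S u v

  ConnectedGraph : Set
  ConnectedGraph = ConnectedSet ⊤

  GoodCut : ℕ → VSet → Set
  GoodCut g X = DisconnectedSet (∁ X) × MinDeg≥ g (∁ X)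

  IsKappa : ℕ → ℕ → Set
  IsKappa g k = (∃ λ X → GoodCut g X × ∣ X ∣ ≡ k)
              × (∀ X → GoodCut g X → k ≤ ∣ X ∣)

  Component : VSet → VSet → Set
  Component X C = (∀ v → v ∈ C → v ∉ X) × ConnectedSet C
                × (∀ u v → u ∈ C → Reach (∁ X) u v → v ∈ C)

  SplitPart : ℕ → VSet → VSet → VSet → Set
  SplitPart g C A B = (A ∪ B ≡ C) × (A ∩ B ≡ ⊥) × Nonempty A × Nonempty B
                    × MinDeg≥ g A × MinDeg≥ g B

  Splittable : ℕ → VSet → Set
  Splittable g C = ∃ λ A → ∃ λ B → SplitPart g C A B

  IsA : ℕ → VSet → ℕ → Set
  IsA g C m = ∃ λ A → ∃ λ B → SplitPart g C A B × ∣ B ∣ ≤ ∣ A ∣ × ∣ A ∣ ≡ m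
            × (∀ A' B' → SplitPart g C A' B' → ∣ B' ∣ ≤ ∣ A' ∣ →
                 ∣ A ∣ ∸ ∣ B ∣ ≤ ∣ A' ∣ ∸ ∣ B' ∣)

  -- min{a(X), c(X)} = m, i.e. m is the minimum over all components C of G - X
  -- of a(C) (C splittable) resp. |C| (C non-splittable)
  IsMinAC : ℕ → VSet → ℕ → Set
  IsMinAC g X m =
      (∃ λ C → Component X C × ((Splittable g C × IsA g C m) ⊎ (¬ Splittable g C × ∣ C ∣ ≡ m)))
    × (∀ C → Component X C →
         (∀ a → IsA g C a → m ≤ a) × (¬ Splittable g C → m ≤ ∣ C ∣))

  IsCg : ℕ → ℕ → Set
  IsCg g c = (∃ λ X → GoodCut g X × ∃ λ m → IsMinAC g X m × ∣ X ∣ + m ≡ c)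
           × (∀ X → GoodCut g X → ∀ m → IsMinAC g X m → c ≤ ∣ X ∣ + m)

{-# OPTIONS --safe #-}
module Submission where

-- c^g(G) is a minimum over all g-good-neighbor cuts, so it is at most the value |X| + min{a(X), c(X)}
-- of any one cut X.  What has to be shown is that the
-- minimum exists; on a finite graph every notion involved is decidable, so the least-number
-- principle provides it.
-- For sharpness take a hub joined to two disjoint copies of K_{g+1}.  Every set of minimum degree
-- at least g has more than g vertices, so every cut X of a connected graph has |X| ≥ 1 and
-- min{a(X), c(X)} ≥ g + 1.  The hub alone is a cut attaining both bounds, since each copy of
-- K_{g+1} is a component that is too small to split.

open import Defs hiding (sym)
open import Data.Bool using (Bool; true; false)
import Data.Bool.Properties as Bool
open import Data.Empty using (⊥-elim)
open import Data.Fin using (Fin; zero; suc)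
open import Data.Fin.Properties using (all?; any?) renaming (_≟_ to _≟ᶠ_)
open import Data.Fin.Subset
  using (Subset; _∈_; _∉_; _⊆_; ∁; _∩_; _∪_; ⊤; ⊥; ⁅_⁆; ∣_∣; Nonempty; inside; outside)
open import Data.Fin.Subset.Properties
  using ( _∈?_; nonempty?; anySubset?; Empty-unique; drop-there; ∈⊤; ∉⊥
        ; ∣p∣≤n; ∣p∣≤∣x∷p∣; ∣⊤∣≡n; ∣⊥∣≡0; ∣p∣≡n⇒p≡⊤; ∣∁p∣≡n∸∣p∣; ∣⁅x⁆∣≡1
        ; p⊆q⇒∣p∣≤∣q∣; p⊂q⇒∣p∣<∣q∣; p⊂q⇒∁p⊃∁q; p⊆p∪q; p∩q⊆p
        ; x∈p∪q⁺; x∈p∪q⁻; x∈p∩q⁺; x∈p∩q⁻; x∈⁅x⁆; x∈⁅y⁆⇒x≡y; x≢y⇒x∉⁅y⁆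
        ; x∈∁p⇒x∉p; x∉p⇒x∈∁p )
open import Data.Nat using (ℕ; zero; suc; _+_; _∸_; _≤_; _<_; z≤n; s≤s; _≤?_; _≟_)
open import Data.Nat.Induction using (<-rec)
open import Data.Nat.Properties
  using ( ≤-refl; ≤-trans; <-≤-trans; ≤-<-trans; <⇒≤; ≤-pred; ≮⇒≥; <-irrefl; +-suc; +-identityʳ
        ; +-monoʳ-≤; +-mono-≤; m+n∸m≡n; m≤n+m; anyUpTo?; allUpTo?; module ≤-Reasoning )
open import Data.Product using (∃; ∃₂; _×_; _,_; proj₂)
open import Data.Sum using (inj₁; inj₂)
open import Data.Vec using ([]; _∷_; _++_; there)
open import Data.Vec.Properties using (≡-dec; lookup∘tabulate; lookup⇒[]=; []=⇒lookup)
open import Function using (_∘_; mk⇔)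
open import Relation.Binary.PropositionalEquality
  using (_≡_; _≢_; refl; sym; trans; cong; cong₂; subst; module ≡-Reasoning)
open import Relation.Nullary
  using (¬_; Dec; yes; no; does; contradiction; ¬?; _×-dec_; _⊎-dec_; _→-dec_)
open import Relation.Nullary.Decidable using (map′; decidable-stable; dec-true; dec-false; does-⇔)
open import Relation.Unary using (Pred; Decidable)

∣p∪q∣≤∣p∣+∣q∣ : ∀ {m} (p q : Subset m) → ∣ p ∪ q ∣ ≤ ∣ p ∣ + ∣ q ∣
∣p∪q∣≤∣p∣+∣q∣ []            []            = z≤n
∣p∪q∣≤∣p∣+∣q∣ (inside ∷ p)  (x ∷ q)       =
  s≤s (≤-trans (∣p∪q∣≤∣p∣+∣q∣ p q) (+-monoʳ-≤ ∣ p ∣ (∣p∣≤∣x∷p∣ x q)))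
∣p∪q∣≤∣p∣+∣q∣ (outside ∷ p) (inside ∷ q)  =
  subst (suc ∣ p ∪ q ∣ ≤_) (sym (+-suc ∣ p ∣ ∣ q ∣)) (s≤s (∣p∪q∣≤∣p∣+∣q∣ p q))
∣p∪q∣≤∣p∣+∣q∣ (outside ∷ p) (outside ∷ q) = ∣p∪q∣≤∣p∣+∣q∣ p q

∣p++q∣≡∣p∣+∣q∣ : ∀ {a b} (p : Subset a) (q : Subset b) → ∣ p ++ q ∣ ≡ ∣ p ∣ + ∣ q ∣
∣p++q∣≡∣p∣+∣q∣ []            q = refl
∣p++q∣≡∣p∣+∣q∣ (inside ∷ p)  q = cong suc (∣p++q∣≡∣p∣+∣q∣ p q)
∣p++q∣≡∣p∣+∣q∣ (outside ∷ p) q = ∣p++q∣≡∣p∣+∣q∣ p q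

0<∣p∣⇒nonempty : ∀ {m} (p : Subset m) → 0 < ∣ p ∣ → Nonempty p
0<∣p∣⇒nonempty {m} p 0<∣p∣ with nonempty? p
... | yes ne    = ne
... | no empty  = contradiction (subst (0 <_) ∣p∣≡0 0<∣p∣) λ ()
  where
  ∣p∣≡0 : ∣ p ∣ ≡ 0
  ∣p∣≡0 = trans (cong ∣_∣ (Empty-unique empty)) (∣⊥∣≡0 m)

module GraphProperties (G : Graph) where

  adj⇒∈N : ∀ {v w} → adj G v w ≡ true → w ∈ N G v
  adj⇒∈N {v} {w} e = lookup⇒[]= w (N G v) (trans (lookup∘tabulate (adj G v) w) e)

  ∈N⇒adj : ∀ {v w} → w ∈ N G v → adj G v w ≡ true
  ∈N⇒adj {v} {w} w∈Nv = trans (sym (lookup∘tabulate (adj G v) w)) ([]=⇒lookup w∈Nv)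

  v∉Nv : ∀ v → v ∉ N G v
  v∉Nv v v∈Nv with trans (sym (irrefl G v)) (∈N⇒adj v∈Nv)
  ... | ()

  Reach⇒∈ : ∀ {S u v} → Reach G S u v → u ∈ S
  Reach⇒∈ (here u∈S)   = u∈S
  Reach⇒∈ (step r _ _) = Reach⇒∈ r

  ClosedIn : VSet G → VSet G → Set
  ClosedIn S T = ∀ {w x} → w ∈ T → adj G w x ≡ true → x ∈ S → x ∈ T

  Reach-closed : ∀ {S T u v} → ClosedIn S T → u ∈ T → Reach G S u v → v ∈ T
  Reach-closed closed u∈T (here _)       = u∈T
  Reach-closed closed u∈T (step r e x∈S) = closed (Reach-closed closed u∈T r) e x∈S

  degIn-mono : ∀ {S T} v → S ⊆ T → degIn G S v ≤ degIn G T v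
  degIn-mono {S} {T} v S⊆T = p⊆q⇒∣p∣≤∣q∣ λ w∈ →
    let w∈S , w∈Nv = x∈p∩q⁻ S (N G v) w∈ in x∈p∩q⁺ (S⊆T w∈S , w∈Nv)

  degIn<size : ∀ {S v} → v ∈ S → degIn G S v < ∣ S ∣
  degIn<size {S} {v} v∈S = p⊂q⇒∣p∣<∣q∣ (p∩q⊆p S (N G v) , v , v∈S , v∉Nv v ∘ proj₂ ∘ x∈p∩q⁻ S (N G v))

  minDeg-size : ∀ {g A} → Nonempty A → MinDeg≥ G g A → suc g ≤ ∣ A ∣
  minDeg-size (v , v∈A) minDeg = ≤-<-trans (minDeg v v∈A) (degIn<size v∈A)

  component-minDeg : ∀ {g X C} → GoodCut G g X → Component G X C → MinDeg≥ G g C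
  component-minDeg {g} {X} {C} (_ , minDeg) (C∩X≡∅ , _ , closed) v v∈C =
    ≤-trans (minDeg v v∈∁X) (p⊆q⇒∣p∣≤∣q∣ ∁X∩Nv⊆C∩Nv)
    where
    v∈∁X : v ∈ ∁ X
    v∈∁X = x∉p⇒x∈∁p (C∩X≡∅ v v∈C)
    ∁X∩Nv⊆C∩Nv : ∁ X ∩ N G v ⊆ C ∩ N G v
    ∁X∩Nv⊆C∩Nv {w} w∈ = let w∈∁X , w∈Nv = x∈p∩q⁻ (∁ X) (N G v) w∈ in
      x∈p∩q⁺ (closed v w v∈C (step (here v∈∁X) (∈N⇒adj w∈Nv) w∈∁X) , w∈Nv)

  component-size : ∀ {g X C} → GoodCut G g X → Component G X C → suc g ≤ ∣ C ∣
  component-size cut comp@(_ , (nonempty , _) , _) = minDeg-size nonempty (component-minDeg cut comp)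

  IsA-size : ∀ {g C a} → IsA G g C a → suc g ≤ a
  IsA-size (A , B , (_ , _ , A≢∅ , _ , minDegA , _) , _ , refl , _) = minDeg-size A≢∅ minDegA

  IsMinAC-size : ∀ {g X m} → GoodCut G g X → IsMinAC G g X m → suc g ≤ m
  IsMinAC-size cut ((C , comp , inj₁ (_ , isA)) , _)  = IsA-size isA
  IsMinAC-size cut ((C , comp , inj₂ (_ , refl)) , _) = component-size cut comp

  goodCut-size : ∀ {g X} → ConnectedGraph G → GoodCut G g X → 1 ≤ ∣ X ∣
  goodCut-size {X = X} (_ , connected) ((u , v , _ , _ , ¬reach) , _) with ∣ X ∣ in ∣X∣≡
  ... | suc _ = s≤s z≤n
  ... | zero  = ⊥-elim (¬reach (subst (λ S → Reach G S u v) (sym ∁X≡⊤) (connected u v ∈⊤ ∈⊤)))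
    where
    ∁X≡⊤ : ∁ X ≡ ⊤
    ∁X≡⊤ = ∣p∣≡n⇒p≡⊤ (trans (∣∁p∣≡n∸∣p∣ X) (cong (n G ∸_) ∣X∣≡))

  splittable-size : ∀ {g C} → Splittable G g C → suc g < ∣ C ∣
  splittable-size {C = C} (A , B , A∪B≡C , A∩B≡∅ , A≢∅ , (y , y∈B) , minDegA , _) =
    ≤-<-trans (minDeg-size A≢∅ minDegA) (p⊂q⇒∣p∣<∣q∣ (A⊆C , y , toC (x∈p∪q⁺ (inj₂ y∈B)) , y∉A))
    where
    toC : ∀ {x} → x ∈ A ∪ B → x ∈ C
    toC = subst (_ ∈_) A∪B≡C
    A⊆C : A ⊆ C
    A⊆C = toC ∘ x∈p∪q⁺ ∘ inj₁
    y∉A : y ∉ A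
    y∉A y∈A = ∉⊥ (subst (y ∈_) A∩B≡∅ (x∈p∩q⁺ (y∈A , y∈B)))

  CgValue : ℕ → ℕ → Set
  CgValue g c = ∃ λ X → GoodCut G g X × ∃ λ m → IsMinAC G g X m × ∣ X ∣ + m ≡ c

  IsClique : VSet G → Set
  IsClique C = ∀ {u v} → u ∈ C → v ∈ C → u ≢ v → adj G u v ≡ true

  clique-connected : ∀ {C} → IsClique C → Nonempty C → ConnectedSet G C
  clique-connected {C} clique nonempty = nonempty , reach
    where
    reach : ∀ u v → u ∈ C → v ∈ C → Reach G C u v
    reach u v u∈C v∈C with u ≟ᶠ v
    ... | yes refl = here u∈C
    ... | no u≢v   = step (here u∈C) (clique u∈C v∈C u≢v) v∈C

  clique-degree : ∀ {C v} → IsClique C → v ∈ C → ∣ C ∣ ≤ suc (degIn G C v)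
  clique-degree {C} {v} clique v∈C = begin
    ∣ C ∣                          ≤⟨ p⊆q⇒∣p∣≤∣q∣ C⊆v∪Nv ⟩
    ∣ ⁅ v ⁆ ∪ (C ∩ N G v) ∣        ≤⟨ ∣p∪q∣≤∣p∣+∣q∣ ⁅ v ⁆ (C ∩ N G v) ⟩
    ∣ ⁅ v ⁆ ∣ + degIn G C v        ≡⟨ cong (_+ degIn G C v) (∣⁅x⁆∣≡1 v) ⟩
    suc (degIn G C v)              ∎
    where
    open ≤-Reasoning
    C⊆v∪Nv : C ⊆ ⁅ v ⁆ ∪ (C ∩ N G v)
    C⊆v∪Nv {w} w∈C with w ≟ᶠ v
    ... | yes refl = x∈p∪q⁺ (inj₁ (x∈⁅x⁆ v))
    ... | no w≢v   = x∈p∪q⁺ (inj₂ (x∈p∩q⁺ (w∈C , adj⇒∈N (clique v∈C w∈C (w≢v ∘ sym)))))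

allSubsets? : ∀ {m ℓ} {P : Pred (Subset m) ℓ} → Decidable P → Dec (∀ p → P p)
allSubsets? {P = P} P? with anySubset? (¬? ∘ P?)
... | yes (p , ¬Pp) = no λ all → ¬Pp (all p)
... | no ¬∃¬P       = yes λ p → decidable-stable (P? p) (¬∃¬P ∘ (p ,_))

LeastUpTo : ∀ {ℓ} → Pred ℕ ℓ → ℕ → Set ℓ
LeastUpTo P j = ∃ λ i → P i × (∀ {i′} → P i′ → i ≤ i′) × i ≤ j

least : ∀ {ℓ} {P : Pred ℕ ℓ} → Decidable P → ∀ {j} → P j → LeastUpTo P j
least {P = P} P? {j} = <-rec (λ j → P j → LeastUpTo P j) go j
  where
  go : ∀ j → (∀ {i} → i < j → P i → LeastUpTo P i) → P j → LeastUpTo P j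
  go j smaller Pj with anyUpTo? P? j
  ... | yes (i , i<j , Pi) = let k , Pk , minimal , k≤i = smaller i<j Pi
                             in  k , Pk , minimal , ≤-trans k≤i (<⇒≤ i<j)
  ... | no none            = j , Pj , (λ Pi′ → ≮⇒≥ λ i′<j → none (_ , i′<j , Pi′)) , ≤-refl

module Decidability (G : Graph) where

  open GraphProperties G

  module Explore (S : VSet G) (u : Fin (n G)) where

    Explored : VSet G → Set
    Explored T = u ∈ T × (∀ {w} → w ∈ T → Reach G S u w)

    EdgeLeaving : VSet G → Set
    EdgeLeaving T = ∃₂ λ w x → w ∈ T × adj G w x ≡ true × x ∈ S × x ∉ T

    edgeLeaving? : ∀ T → Dec (EdgeLeaving T)
    edgeLeaving? T = any? λ w → any? λ x →
      w ∈? T ×-dec adj G w x Bool.≟ true ×-dec x ∈? S ×-dec ¬? (x ∈? T)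

    closed-if-no-edge-leaving : ∀ {T} → ¬ EdgeLeaving T → ClosedIn S T
    closed-if-no-edge-leaving {T} none {w} {x} w∈T e x∈S =
      decidable-stable (x ∈? T) λ x∉T → none (w , x , w∈T , e , x∈S , x∉T)

    -- every round adds a vertex to T, so ∣ ∁ T ∣ bounds the number of rounds
    explore : ∀ fuel T → ∣ ∁ T ∣ ≤ fuel → Explored T → ∃ λ T → Explored T × ClosedIn S T
    explore fuel T bound explored@(u∈T , reachable) with edgeLeaving? T
    ... | no none = T , explored , closed-if-no-edge-leaving none
    ... | yes (w , x , w∈T , e , x∈S , x∉T) = continue fuel bound
      where
      T⁺ : VSet G
      T⁺ = T ∪ ⁅ x ⁆
      shrinks : ∣ ∁ T⁺ ∣ < ∣ ∁ T ∣
      shrinks = p⊂q⇒∣p∣<∣q∣ (p⊂q⇒∁p⊃∁q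
        (p⊆p∪q ⁅ x ⁆ , x , x∈p∪q⁺ (inj₂ (x∈⁅x⁆ x)) , x∉T))
      reachable⁺ : ∀ {y} → y ∈ T⁺ → Reach G S u y
      reachable⁺ y∈T⁺ with x∈p∪q⁻ T ⁅ x ⁆ y∈T⁺
      ... | inj₁ y∈T = reachable y∈T
      ... | inj₂ y∈x with x∈⁅y⁆⇒x≡y x y∈x
      ... | refl = step (reachable w∈T) e x∈S
      continue : ∀ fuel → ∣ ∁ T ∣ ≤ fuel → ∃ λ T → Explored T × ClosedIn S T
      continue zero       bound = contradiction (<-≤-trans shrinks bound) λ ()
      continue (suc fuel) bound =
        explore fuel T⁺ (≤-pred (<-≤-trans shrinks bound)) (x∈p∪q⁺ (inj₁ u∈T) , reachable⁺)

  reachableSet : ∀ {S u} → u ∈ S → ∃ λ T → Explore.Explored S u T × ClosedIn S T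
  reachableSet {S} {u} u∈S = Explore.explore S u (n G) ⁅ u ⁆ (∣p∣≤n (∁ ⁅ u ⁆)) (x∈⁅x⁆ u , reach-u)
    where
    reach-u : ∀ {w} → w ∈ ⁅ u ⁆ → Reach G S u w
    reach-u w∈u with x∈⁅y⁆⇒x≡y u w∈u
    ... | refl = here u∈S

  Reach? : ∀ S u v → Dec (Reach G S u v)
  Reach? S u v with u ∈? S
  ... | no u∉S  = no (u∉S ∘ Reach⇒∈)
  ... | yes u∈S = let T , (u∈T , reachable) , closed = reachableSet u∈S
                  in  map′ reachable (Reach-closed closed u∈T) (v ∈? T)

  minDeg? : ∀ g S → Dec (MinDeg≥ G g S)
  minDeg? g S = all? λ v → v ∈? S →-dec g ≤? degIn G S v

  connectedSet? : ∀ S → Dec (ConnectedSet G S)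
  connectedSet? S = nonempty? S ×-dec
    all? λ u → all? λ v → u ∈? S →-dec v ∈? S →-dec Reach? S u v

  disconnectedSet? : ∀ S → Dec (DisconnectedSet G S)
  disconnectedSet? S = any? λ u → any? λ v → u ∈? S ×-dec v ∈? S ×-dec ¬? (Reach? S u v)

  goodCut? : ∀ g X → Dec (GoodCut G g X)
  goodCut? g X = disconnectedSet? (∁ X) ×-dec minDeg? g (∁ X)

  component? : ∀ X C → Dec (Component G X C)
  component? X C =
    all? (λ v → v ∈? C →-dec ¬? (v ∈? X)) ×-dec connectedSet? C ×-dec
    all? λ u → all? λ v → u ∈? C →-dec Reach? (∁ X) u v →-dec v ∈? C

  infix 4 _≟ˢ_
  _≟ˢ_ : (p q : VSet G) → Dec (p ≡ q)
  _≟ˢ_ = ≡-dec Bool._≟_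

  splitPart? : ∀ g C A B → Dec (SplitPart G g C A B)
  splitPart? g C A B = A ∪ B ≟ˢ C ×-dec A ∩ B ≟ˢ ⊥ ×-dec nonempty? A ×-dec nonempty? B ×-dec
    minDeg? g A ×-dec minDeg? g B

  splittable? : ∀ g C → Dec (Splittable G g C)
  splittable? g C = anySubset? λ A → anySubset? λ B → splitPart? g C A B

  IsA? : ∀ g C a → Dec (IsA G g C a)
  IsA? g C a = anySubset? λ A → anySubset? λ B →
    splitPart? g C A B ×-dec ∣ B ∣ ≤? ∣ A ∣ ×-dec ∣ A ∣ ≟ a ×-dec
    allSubsets? λ A′ → allSubsets? λ B′ →
      splitPart? g C A′ B′ →-dec ∣ B′ ∣ ≤? ∣ A′ ∣ →-dec ∣ A ∣ ∸ ∣ B ∣ ≤? ∣ A′ ∣ ∸ ∣ B′ ∣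

  IsA-bounded : ∀ {g C a} → IsA G g C a → a < suc (n G)
  IsA-bounded (A , _ , _ , _ , refl , _) = s≤s (∣p∣≤n A)

  isLowerBoundOfA? : ∀ g C m → Dec (∀ a → IsA G g C a → m ≤ a)
  isLowerBoundOfA? g C m = map′ (λ below a isA → below (IsA-bounded isA) isA) (λ all {a} _ → all a)
    (allUpTo? (λ a → IsA? g C a →-dec m ≤? a) (suc (n G)))

  IsMinAC? : ∀ g X m → Dec (IsMinAC G g X m)
  IsMinAC? g X m =
    anySubset? (λ C → component? X C ×-dec
      (splittable? g C ×-dec IsA? g C m ⊎-dec ¬? (splittable? g C) ×-dec ∣ C ∣ ≟ m))
    ×-dec allSubsets? λ C → component? X C →-dec
      isLowerBoundOfA? g C m ×-dec ¬? (splittable? g C) →-dec m ≤? ∣ C ∣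

  CgValue? : ∀ g c → Dec (CgValue g c)
  CgValue? g c = map′ (λ (X , cut , m , _ , isMin , eq) → X , cut , m , isMin , eq)
    (λ (X , cut , m , isMin , eq) → X , cut , m , s≤s (subst (m ≤_) eq (m≤n+m m ∣ X ∣)) , isMin , eq)
    (anySubset? λ X → goodCut? g X ×-dec
      anyUpTo? (λ m → IsMinAC? g X m ×-dec ∣ X ∣ + m ≟ c) (suc c))

  IsCg-exists : ∀ g {j} → CgValue g j → ∃ λ c → IsCg G g c × c ≤ j
  IsCg-exists g value =
    let c , cValue , minimal , c≤j = least (CgValue? g) value
    in  c , (cValue , λ X cut m isMin → minimal (X , cut , m , isMin , refl)) , c≤j

module HubWithTwoCliques (g : ℕ) where

  k : ℕ
  k = suc g

  Left : Subset (k + k)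
  Left = ⊤ {k} ++ ⊥ {k}

  side : Bool → Subset (k + k)
  side true  = Left
  side false = ∁ Left

  side-unique : ∀ {i} b c → i ∈ side b → i ∈ side c → b ≡ c
  side-unique true  true  _    _    = refl
  side-unique false false _    _    = refl
  side-unique true  false i∈L  i∈∁L = contradiction i∈L (x∈∁p⇒x∉p i∈∁L)
  side-unique false true  i∈∁L i∈L  = contradiction i∈L (x∈∁p⇒x∉p i∈∁L)

  side-of : ∀ i → ∃ λ b → i ∈ side b
  side-of i with i ∈? Left
  ... | yes i∈L = true  , i∈L
  ... | no  i∉L = false , x∉p⇒x∈∁p i∉L

  ∣side∣ : ∀ b → ∣ side b ∣ ≡ k
  ∣side∣ true = begin
    ∣ ⊤ {k} ++ ⊥ {k} ∣    ≡⟨ ∣p++q∣≡∣p∣+∣q∣ (⊤ {k}) (⊥ {k}) ⟩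
    ∣ ⊤ {k} ∣ + ∣ ⊥ {k} ∣ ≡⟨ cong₂ _+_ (∣⊤∣≡n k) (∣⊥∣≡0 k) ⟩
    k + 0                 ≡⟨ +-identityʳ k ⟩
    k                     ∎
    where open ≡-Reasoning
  ∣side∣ false = begin
    ∣ ∁ Left ∣            ≡⟨ ∣∁p∣≡n∸∣p∣ Left ⟩
    k + k ∸ ∣ Left ∣      ≡⟨ cong (k + k ∸_) (∣side∣ true) ⟩
    k + k ∸ k             ≡⟨ m+n∸m≡n k k ⟩
    k                     ∎
    where open ≡-Reasoning

  side-nonempty : ∀ b → Nonempty (side b)
  side-nonempty b = 0<∣p∣⇒nonempty (side b) (subst (0 <_) (sym (∣side∣ b)) (s≤s z≤n))

  Vertex : Set
  Vertex = Fin (suc (k + k))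

  hub : Vertex
  hub = zero

  data Edge : Vertex → Vertex → Set where
    hub-leaf  : ∀ {i} → Edge hub (suc i)
    leaf-hub  : ∀ {i} → Edge (suc i) hub
    leaf-leaf : ∀ {i j} b → i ≢ j → i ∈ side b → j ∈ side b → Edge (suc i) (suc j)

  edge-sym : ∀ {u v} → Edge u v → Edge v u
  edge-sym hub-leaf                = leaf-hub
  edge-sym leaf-hub                = hub-leaf
  edge-sym (leaf-leaf b i≢j i∈ j∈) = leaf-leaf b (i≢j ∘ sym) j∈ i∈

  edge-irrefl : ∀ {v} → ¬ Edge v v
  edge-irrefl (leaf-leaf _ i≢i _ _) = i≢i refl

  edge? : ∀ u v → Dec (Edge u v)
  edge? zero    zero    = no λ ()
  edge? zero    (suc j) = yes hub-leaf
  edge? (suc i) zero    = yes leaf-hub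
  edge? (suc i) (suc j) with i ≟ᶠ j | side-of i
  ... | yes refl | _       = no edge-irrefl
  ... | no  i≢j  | b , i∈b with j ∈? side b
  ...   | yes j∈b = yes (leaf-leaf b i≢j i∈b j∈b)
  ...   | no  j∉b = no λ { (leaf-leaf c _ i∈c j∈c) →
                      j∉b (subst (λ c → j ∈ side c) (side-unique c b i∈c i∈b) j∈c) }

  G₀ : Graph
  G₀ = record
    { n      = suc (k + k)
    ; adj    = λ u v → does (edge? u v)
    ; sym    = λ u v → does-⇔ (mk⇔ edge-sym edge-sym) (edge? u v) (edge? v u)
    ; irrefl = λ v → dec-false (edge? v v) edge-irrefl
    }

  open GraphProperties G₀

  edge⇒adj : ∀ {u v} → Edge u v → adj G₀ u v ≡ true
  edge⇒adj {u} {v} = dec-true (edge? u v)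

  adj⇒edge : ∀ {u v} → adj G₀ u v ≡ true → Edge u v
  adj⇒edge {u} {v} e with edge? u v
  ... | yes uv = uv

  X₀ : VSet G₀
  X₀ = ⁅ hub ⁆

  ∣X₀∣ : ∣ X₀ ∣ ≡ 1
  ∣X₀∣ = ∣⁅x⁆∣≡1 hub

  Block : Bool → VSet G₀
  Block b = outside ∷ side b

  Block⊆∁X₀ : ∀ b → Block b ⊆ ∁ X₀
  Block⊆∁X₀ b {suc i} _ = x∉p⇒x∈∁p (x≢y⇒x∉⁅y⁆ {y = hub} λ ())

  Block-clique : ∀ b → IsClique (Block b)
  Block-clique b {suc i} {suc j} i∈ j∈ u≢v =
    edge⇒adj (leaf-leaf b (u≢v ∘ cong suc) (drop-there i∈) (drop-there j∈))

  Block-closed : ∀ b → ClosedIn (∁ X₀) (Block b)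
  Block-closed b {suc i} {zero}  _  _ hub∈∁X₀ = contradiction (x∈⁅x⁆ hub) (x∈∁p⇒x∉p hub∈∁X₀)
  Block-closed b {suc i} {suc j} i∈ e _ with adj⇒edge {suc i} {suc j} e
  ... | leaf-leaf c _ i∈c j∈c =
    there (subst (λ c → j ∈ side c) (side-unique c b i∈c (drop-there i∈)) j∈c)

  Block-nonempty : ∀ b → Nonempty (Block b)
  Block-nonempty b = let i , i∈ = side-nonempty b in suc i , there i∈

  connected : ConnectedGraph G₀
  connected = (hub , ∈⊤) , λ u v _ _ → reach u v
    where
    to-hub : ∀ u → Reach G₀ ⊤ u hub
    to-hub zero    = here ∈⊤
    to-hub (suc i) = step (here ∈⊤) (edge⇒adj (leaf-hub {i})) ∈⊤
    reach : ∀ u v → Reach G₀ ⊤ u v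
    reach u zero    = to-hub u
    reach u (suc j) = step (to-hub u) (edge⇒adj (hub-leaf {j})) ∈⊤

  hub-cut : GoodCut G₀ g X₀
  hub-cut = disconnected , minDeg
    where
    disconnected : DisconnectedSet G₀ (∁ X₀)
    disconnected =
      let i , i∈L = side-nonempty true
          j , j∈R = side-nonempty false
      in  suc i , suc j , Block⊆∁X₀ true (there i∈L) , Block⊆∁X₀ false (there j∈R) ,
          λ reach → let j∈L = drop-there (Reach-closed (Block-closed true) (there i∈L) reach)
                    in  contradiction (side-unique true false j∈L j∈R) λ ()
    minDeg : MinDeg≥ G₀ g (∁ X₀)
    minDeg zero hub∈∁X₀ = contradiction (x∈⁅x⁆ hub) (x∈∁p⇒x∉p hub∈∁X₀)
    minDeg (suc i) _ =
      let b , i∈b = side-of i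
          deg = degIn G₀ (Block b) (suc i)
          k≤deg+1 = subst (_≤ suc deg) (∣side∣ b) (clique-degree (Block-clique b) (there i∈b))
      in  ≤-trans (≤-pred k≤deg+1) (degIn-mono (suc i) (Block⊆∁X₀ b))

  C₀ : VSet G₀
  C₀ = Block true

  C₀-component : Component G₀ X₀ C₀
  C₀-component = (λ _ → x∈∁p⇒x∉p ∘ Block⊆∁X₀ true)
               , clique-connected (Block-clique true) (Block-nonempty true)
               , λ _ _ u∈C₀ → Reach-closed (Block-closed true) u∈C₀

  C₀-unsplittable : ¬ Splittable G₀ g C₀
  C₀-unsplittable split = <-irrefl (sym (∣side∣ true)) (splittable-size split)

  hub-minAC : IsMinAC G₀ g X₀ k
  hub-minAC = (C₀ , C₀-component , inj₂ (C₀-unsplittable , ∣side∣ true))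
            , λ C comp → (λ _ → IsA-size) , (λ _ → component-size hub-cut comp)

  hub-kappa : IsKappa G₀ g 1
  hub-kappa = (X₀ , hub-cut , ∣X₀∣) , λ X cut → goodCut-size connected cut

  hub-cg : IsCg G₀ g (1 + k)
  hub-cg = (X₀ , hub-cut , k , hub-minAC , cong (_+ k) ∣X₀∣)
         , λ X cut m isMin → +-mono-≤ (goodCut-size connected cut) (IsMinAC-size cut isMin)

theorem3p2 :
    -- the bound
    (∀ (G : Graph) (g k : ℕ) → ConnectedGraph G → IsKappa G g k →
       ∀ X → GoodCut G g X → ∣ X ∣ ≡ k →
       ∀ m → IsMinAC G g X m →
       ∃ λ c → IsCg G g c × c ≤ k + m)
    ×
    -- sharpness: for every g, some connected graph attains equality
    (∀ (g : ℕ) → ∃ λ (G : Graph) → ConnectedGraph G ×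
       ∃ λ k → IsKappa G g k × ∃ λ X → GoodCut G g X × ∣ X ∣ ≡ k ×
       ∃ λ m → IsMinAC G g X m × IsCg G g (k + m))
theorem3p2 =
    (λ G g k _ _ X cut ∣X∣≡k m isMin → Decidability.IsCg-exists G g (X , cut , m , isMin , cong (_+ m) ∣X∣≡k))
  , λ g → let open HubWithTwoCliques g in
          G₀ , connected , 1 , hub-kappa , X₀ , hub-cut , ∣X₀∣ , k , hub-minAC , hub-cg
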